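{- For all sufficiently large $n$, there is a covering $3$-colouring of the complete $4$-graph $K_n^{(4)}$ with no $5$-set of vertices whose five $4$-subsets receive all three colours.
   Context: $K_n^{(4)}$ is the $4$-uniform hypergraph on $n$ vertices whose edges are all $4$-subsets. A $4$-graph on vertex set $V$ is a covering if every $3$-subset of $V$ is contained in some edge. A colouring of the edges of $K_n^{(4)}$ with $3$ colours is a covering $3$-colouring if, for each colour, the $4$-graph on all $n$ vertices formed by the edges of that colour is a covering. -}

module Defs where

open import Data.Nat using (ℕ)
open import Data.Fin using (Fin)
open import Data.Fin.Subset using (Subset; ∣_∣; _∈_; _∉_; _∪_; ⁅_⁆; _-_)
open import Data.Product using (∃; Σ; _×_; _,_)
open import Relation.Binary.PropositionalEquality using (_≡_)
open import Relation.Nullary using (¬_)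

-- A 3-colouring of the edges of K_n^(4): a colour (Fin 3) for every subset
-- of the vertex set Fin n; only its values on 4-element subsets are relevant.
Colouring : ℕ → Set
Colouring n = Subset n → Fin 3

CoversColour : {n : ℕ} → Colouring n → Fin 3 → Set
CoversColour {n} χ k =
  (T : Subset n) → ∣ T ∣ ≡ 3 → ∃ λ x → x ∉ T × χ (T ∪ ⁅ x ⁆) ≡ k

CoveringColouring : {n : ℕ} → Colouring n → Set
CoveringColouring χ = (k : Fin 3) → CoversColour χ k

Rainbow5 : {n : ℕ} → Colouring n → Subset n → Set
Rainbow5 χ S = ∣ S ∣ ≡ 5 × ((k : Fin 3) → ∃ λ x → x ∈ S × χ (S - x) ≡ k)

module Submission where

-- Take as vertices the 50 points of the projective line over 𝔽₄₉ = 𝔽₇(√3).  A 4-set is coloured 0 unless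
-- its cross-ratio lies in 𝔽₇, i.e. unless its points lie on a common circle (a copy of the line over 𝔽₇);
-- concyclic 4-sets get colour 2 or 1 according to whether the cross-ratio is a primitive sixth root of
-- unity or not.  Three points determine a circle, so two concyclic 4-subsets of a 5-set make all five
-- of them concyclic, and no 5-set sees colours 0, 1 and 2 together.  That every triple extends to 4-sets
-- of all three colours is checked by evaluation.  Every larger n is reached by repeatedly adding a twin
-- of a vertex, which preserves both properties.

open import Defs
open import Data.Nat using (ℕ; _≥_)
open import Data.Fin.Subset using (Subset)
open import Data.Product using (∃; _×_)
open import Relation.Nullary using (¬_)

open import Level using (0ℓ; _⊔_)
open import Algebra.Bundles using (CommutativeRing)
open import Algebra.Structures using (IsCommutativeRing)
import Algebra.Properties.Ring as RingProperties
import Algebra.Solver.Ring.NaturalCoefficients.Default as NaturalSolver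
open import Data.Bool using (T; true; false; if_then_else_)
open import Data.Empty using (⊥; ⊥-elim)
open import Data.Fin using (Fin; toℕ; fromℕ<; punchIn) renaming (zero to fzero; suc to fsuc)
import Data.Fin as Fin
open import Data.Fin.Patterns using (0F; 1F; 2F; 3F; 4F)
open import Data.Fin.Permutation
  using (Permutation′; _⟨$⟩ʳ_; _⟨$⟩ˡ_; _∘ₚ_; transpose; flip; inverseʳ; inverseˡ; punchIn-permute)
import Data.Fin.Permutation as Permutation
open import Data.Fin.Permutation.Transposition.List using (TranspositionList; eval; decompose; eval-decompose)
open import Data.Fin.Properties using (_≟_; <-cmp; toℕ-fromℕ<; all?; any?)
open import Data.Fin.Subset using (Side; inside; outside; ∣_∣; _∈_; _∉_; _∪_; ⁅_⁆) renaming (_-_ to _∖_; ⊥ to ∅)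
open import Data.Fin.Subset.Properties using (∪-identityʳ) renaming (∉⊥ to ∉∅)
open import Data.List using (List; []; _∷_; map; length; lookup; removeAt; upTo)
open import Data.List.Membership.Propositional using () renaming (_∈_ to _∈ₗ_)
open import Data.List.Membership.Propositional.Properties using (∈-map⁺; ∈-lookup)
open import Data.List.Properties using (length-map)
open import Data.List.Relation.Unary.All using (All; []; _∷_)
import Data.List.Relation.Unary.All as All
import Data.List.Relation.Unary.All.Properties as All
open import Data.List.Relation.Unary.AllPairs using (AllPairs; []; _∷_)
import Data.List.Relation.Unary.AllPairs as AllPairs
import Data.List.Relation.Unary.AllPairs.Properties as AllPairs
open import Data.List.Relation.Unary.Any using (Any; here; there)
import Data.List.Relation.Unary.Any as Any
open import Data.List.Relation.Unary.Any.Properties using (lookup-index)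
open import Data.Nat using (zero; suc; pred; NonZero; _<_; _<?_; _<ᵇ_; _≡ᵇ_; _%_; _/_; z<s; s<s)
import Data.Nat as ℕ
open import Data.Nat.DivMod using (%-distribˡ-+; %-distribˡ-*; m*n%n≡0; m%n%n≡m%n; m%n<n)
open import Data.Nat.Divisibility using (_∣_; m%n≡0⇒n∣m; n∣m⇒m%n≡0)
open import Data.Nat.Primality using (Prime; prime?; euclidsLemma)
open import Data.Nat.Properties using (suc-pred; suc-injective; <⇒≢; ≡ᵇ⇒≡; ≡⇒≡ᵇ; m+[n∸m]≡n; allUpTo?)
import Data.Nat.Properties as ℕ
open import Data.Product using (_,_; proj₁; proj₂)
open import Data.Product.Relation.Binary.Pointwise.NonDependent using (Pointwise; ×-isEquivalence)
open import Data.Sum using (_⊎_; inj₁; inj₂)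
import Data.Sum as Sum
open import Data.Unit using (tt)
open import Data.Vec using ([]; _∷_; here; there; zipWith)
open import Data.Vec.Properties using (zipWith-identityʳ)
open import Function using (_∘_; id)
open import Relation.Binary.Definitions using (tri<; tri≈; tri>)
open import Relation.Binary.PropositionalEquality
  using (_≡_; _≢_; _≗_; refl; sym; trans; cong; cong₂; subst; module ≡-Reasoning)
open import Relation.Binary.Structures using (IsEquivalence)
open import Relation.Nullary using (Dec; yes; no; does)
open import Relation.Nullary.Decidable using (map′; toWitness; ¬?; _×-dec_; _→-dec_)

-- Arithmetic modulo n

-- Residues are represented by arbitrary naturals and negation is multiplication by n − 1, so every
-- operation is plain ℕ arithmetic.
module Modular (n : ℕ) .{{_ : NonZero n}} where

  infix 4 _≈_ _≈?_
  infixl 6 _+_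
  infixl 7 _*_

  record _≈_ (a b : ℕ) : Set where
    constructor mod
    field residue-≡ : a ℕ.% n ≡ b ℕ.% n
  open _≈_

  _+_ _*_ : ℕ → ℕ → ℕ
  _+_ = ℕ._+_
  _*_ = ℕ._*_

  -_ : ℕ → ℕ
  - a = pred n * a

  ≈-isEquivalence : IsEquivalence _≈_
  ≈-isEquivalence = record
    { refl  = mod refl
    ; sym   = λ (mod p) → mod (sym p)
    ; trans = λ (mod p) (mod q) → mod (trans p q)
    }

  open IsEquivalence ≈-isEquivalence using () renaming (refl to ≈-refl; trans to ≈-trans)

  ≡⇒≈ : ∀ {a b} → a ≡ b → a ≈ b
  ≡⇒≈ a≡b = mod (cong (ℕ._% n) a≡b)

  ≈-residue : ∀ a → a ≈ a ℕ.% n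
  ≈-residue a = mod (sym (m%n%n≡m%n a n))

  _≈?_ : ∀ a b → Dec (a ≈ b)
  a ≈? b = map′ mod residue-≡ (a ℕ.% n ℕ.≟ b ℕ.% n)

  +-cong : ∀ {a b c d} → a ≈ b → c ≈ d → a + c ≈ b + d
  +-cong {a} {b} {c} {d} (mod a≡b) (mod c≡d) = mod (begin
    (a + c) ℕ.% n                   ≡⟨ %-distribˡ-+ a c n ⟩
    (a ℕ.% n + c ℕ.% n) ℕ.% n       ≡⟨ cong₂ (λ x y → (x + y) ℕ.% n) a≡b c≡d ⟩
    (b ℕ.% n + d ℕ.% n) ℕ.% n       ≡⟨ %-distribˡ-+ b d n ⟨
    (b + d) ℕ.% n                   ∎)
    where open ≡-Reasoning

  *-cong : ∀ {a b c d} → a ≈ b → c ≈ d → a * c ≈ b * d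
  *-cong {a} {b} {c} {d} (mod a≡b) (mod c≡d) = mod (begin
    (a * c) ℕ.% n                   ≡⟨ %-distribˡ-* a c n ⟩
    (a ℕ.% n * (c ℕ.% n)) ℕ.% n     ≡⟨ cong₂ (λ x y → (x * y) ℕ.% n) a≡b c≡d ⟩
    (b ℕ.% n * (d ℕ.% n)) ℕ.% n     ≡⟨ %-distribˡ-* b d n ⟨
    (b * d) ℕ.% n                   ∎)
    where open ≡-Reasoning

  -‿inverseˡ : ∀ a → - a + a ≈ 0
  -‿inverseˡ a = mod (begin
    (pred n * a + a) ℕ.% n          ≡⟨ cong (ℕ._% n) (ℕ.+-comm (pred n * a) a) ⟩
    (suc (pred n) * a) ℕ.% n        ≡⟨ cong (λ m → (m * a) ℕ.% n) (suc-pred n) ⟩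
    (n * a) ℕ.% n                   ≡⟨ cong (ℕ._% n) (ℕ.*-comm n a) ⟩
    (a * n) ℕ.% n                   ≡⟨ m*n%n≡0 a n ⟩
    0                               ≡⟨ m*n%n≡0 0 n ⟨
    0 ℕ.% n                         ∎)
    where open ≡-Reasoning

  isCommutativeRing : IsCommutativeRing _≈_ _+_ _*_ -_ 0 1
  isCommutativeRing = record
    { isRing = record
      { +-isAbelianGroup = record
        { isGroup = record
          { isMonoid = record
            { isSemigroup = record
              { isMagma = record { isEquivalence = ≈-isEquivalence ; ∙-cong = +-cong }
              ; assoc = λ a b c → ≡⇒≈ (ℕ.+-assoc a b c)
              }
            ; identity = (λ _ → ≈-refl) , (λ a → ≡⇒≈ (ℕ.+-identityʳ a))
            }
          ; inverse = -‿inverseˡ , λ a → ≈-trans (≡⇒≈ (ℕ.+-comm a (- a))) (-‿inverseˡ a)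
          ; ⁻¹-cong = *-cong (≈-refl {pred n})
          }
        ; comm = λ a b → ≡⇒≈ (ℕ.+-comm a b)
        }
      ; *-cong = *-cong
      ; *-assoc = λ a b c → ≡⇒≈ (ℕ.*-assoc a b c)
      ; *-identity = (λ a → ≡⇒≈ (ℕ.*-identityˡ a)) , (λ a → ≡⇒≈ (ℕ.*-identityʳ a))
      ; distrib = (λ a b c → ≡⇒≈ (ℕ.*-distribˡ-+ a b c)) , (λ a b c → ≡⇒≈ (ℕ.*-distribʳ-+ a b c))
      }
    ; *-comm = λ a b → ≡⇒≈ (ℕ.*-comm a b)
    }

  commutativeRing : CommutativeRing 0ℓ 0ℓ
  commutativeRing = record { isCommutativeRing = isCommutativeRing }

  noZeroDivisors : Prime n → ∀ {a b} → a * b ≈ 0 → a ≈ 0 ⊎ b ≈ 0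
  noZeroDivisors n-prime {a} {b} (mod ab≡0) =
    Sum.map residue-0 residue-0 (euclidsLemma a b n-prime (m%n≡0⇒n∣m (a * b) n (trans ab≡0 0%n≡0)))
    where
    0%n≡0 : 0 ℕ.% n ≡ 0
    0%n≡0 = m*n%n≡0 0 n
    residue-0 : ∀ {m} → n ∣ m → m ≈ 0
    residue-0 {m} n∣m = mod (trans (n∣m⇒m%n≡0 m n n∣m) (sym 0%n≡0))

-- Quadratic extensions

module QuadraticExtension {c ℓ} (R : CommutativeRing c ℓ) (δ : CommutativeRing.Carrier R) where

  private
    module R where
      open CommutativeRing R public
      open RingProperties ring public using (-‿distribˡ-*; -‿distribʳ-*; -‿involutive; -‿anti-homo-+; -0#≈0#)
      open import Relation.Binary.Reasoning.Setoid setoid public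
    open NaturalSolver R.commutativeSemiring using (solve; _:=_; _:+_; _:*_; con)
  open R using (0#; 1#) renaming (Carrier to A)

  infix  4 _≈_
  infixl 6 _+_
  infixl 7 _*_

  Carrier : Set c
  Carrier = A × A

  _≈_ : Carrier → Carrier → Set ℓ
  _≈_ = Pointwise R._≈_ R._≈_

  _+_ : Carrier → Carrier → Carrier
  (a , b) + (c , d) = (a R.+ c , b R.+ d)

  _*_ : Carrier → Carrier → Carrier
  (a , b) * (c , d) = (a R.* c R.+ δ R.* (b R.* d) , a R.* d R.+ b R.* c)

  -_ : Carrier → Carrier
  - (a , b) = (R.- a , R.- b)

  0ₑ 1ₑ : Carrier
  0ₑ = (0# , 0#)
  1ₑ = (1# , 0#)

  ≈-isEquivalence : IsEquivalence _≈_
  ≈-isEquivalence = ×-isEquivalence R.isEquivalence R.isEquivalence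

  open IsEquivalence ≈-isEquivalence using () renaming (trans to ≈-trans)

  +-cong : ∀ {x x′ y y′} → x ≈ x′ → y ≈ y′ → x + y ≈ x′ + y′
  +-cong (p , q) (r , s) = R.+-cong p r , R.+-cong q s

  *-cong : ∀ {x x′ y y′} → x ≈ x′ → y ≈ y′ → x * y ≈ x′ * y′
  *-cong (p , q) (r , s) = R.+-cong (R.*-cong p r) (R.*-cong R.refl (R.*-cong q s)) , R.+-cong (R.*-cong p s) (R.*-cong q r)

  *-assoc : ∀ x y z → (x * y) * z ≈ x * (y * z)
  *-assoc (a , b) (c , d) (e , f) =
      solve 7 (λ δ a b c d e f → (a :* c :+ δ :* (b :* d)) :* e :+ δ :* ((a :* d :+ b :* c) :* f)
                              := a :* (c :* e :+ δ :* (d :* f)) :+ δ :* (b :* (c :* f :+ d :* e))) R.refl δ a b c d e f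
    , solve 7 (λ δ a b c d e f → (a :* c :+ δ :* (b :* d)) :* f :+ (a :* d :+ b :* c) :* e
                              := a :* (c :* f :+ d :* e) :+ b :* (c :* e :+ δ :* (d :* f))) R.refl δ a b c d e f

  *-comm : ∀ x y → x * y ≈ y * x
  *-comm (a , b) (c , d) =
      solve 5 (λ δ a b c d → a :* c :+ δ :* (b :* d) := c :* a :+ δ :* (d :* b)) R.refl δ a b c d
    , solve 4 (λ a b c d → a :* d :+ b :* c := c :* b :+ d :* a) R.refl a b c d

  *-identityˡ : ∀ x → 1ₑ * x ≈ x
  *-identityˡ (a , b) =
      solve 3 (λ δ a b → con 1 :* a :+ δ :* (con 0 :* b) := a) R.refl δ a b
    , solve 2 (λ a b → con 1 :* b :+ con 0 :* a := b) R.refl a b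

  *-distribˡ-+ : ∀ x y z → x * (y + z) ≈ x * y + x * z
  *-distribˡ-+ (a , b) (c , d) (e , f) =
      solve 7 (λ δ a b c d e f → a :* (c :+ e) :+ δ :* (b :* (d :+ f))
                              := (a :* c :+ δ :* (b :* d)) :+ (a :* e :+ δ :* (b :* f))) R.refl δ a b c d e f
    , solve 6 (λ a b c d e f → a :* (d :+ f) :+ b :* (c :+ e)
                            := (a :* d :+ b :* c) :+ (a :* f :+ b :* e)) R.refl a b c d e f

  isCommutativeRing : IsCommutativeRing _≈_ _+_ _*_ -_ 0ₑ 1ₑ
  isCommutativeRing = record
    { isRing = record
      { +-isAbelianGroup = record
        { isGroup = record
          { isMonoid = record
            { isSemigroup = record
              { isMagma = record { isEquivalence = ≈-isEquivalence ; ∙-cong = +-cong }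
              ; assoc = λ (a , b) (c , d) (e , f) → R.+-assoc a c e , R.+-assoc b d f
              }
            ; identity = (λ (a , b) → R.+-identityˡ a , R.+-identityˡ b)
                       , (λ (a , b) → R.+-identityʳ a , R.+-identityʳ b)
            }
          ; inverse = (λ (a , b) → R.-‿inverseˡ a , R.-‿inverseˡ b)
                    , (λ (a , b) → R.-‿inverseʳ a , R.-‿inverseʳ b)
          ; ⁻¹-cong = λ (p , q) → R.-‿cong p , R.-‿cong q
          }
        ; comm = λ (a , b) (c , d) → R.+-comm a c , R.+-comm b d
        }
      ; *-cong = *-cong
      ; *-assoc = *-assoc
      ; *-identity = *-identityˡ , λ x → ≈-trans (*-comm x 1ₑ) (*-identityˡ x)
      ; distrib = *-distribˡ-+ , λ x y z →
          ≈-trans (*-comm (y + z) x) (≈-trans (*-distribˡ-+ x y z) (+-cong (*-comm x y) (*-comm x z)))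
      }
    ; *-comm = *-comm
    }

  commutativeRing : CommutativeRing c ℓ
  commutativeRing = record { isCommutativeRing = isCommutativeRing }

  conj : Carrier → Carrier
  conj (a , b) = (a , R.- b)

  InBase : Carrier → Set ℓ
  InBase (_ , b) = b R.≈ 0#

  InBase-cong : ∀ {x y} → x ≈ y → InBase x → InBase y
  InBase-cong (_ , q) b≈0 = R.trans (R.sym q) b≈0

  InBase-+ : ∀ {x y} → InBase x → InBase y → InBase (x + y)
  InBase-+ p q = R.trans (R.+-cong p q) (R.+-identityʳ 0#)

  InBase-neg : ∀ {x} → InBase x → InBase (- x)
  InBase-neg p = R.trans (R.-‿cong p) R.-0#≈0#

  InBase-conj : ∀ {x} → InBase x → InBase (conj x)
  InBase-conj p = R.trans (R.-‿cong p) R.-0#≈0#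

  InBase-* : ∀ {x y} → InBase x → InBase y → InBase (x * y)
  InBase-* {a , b} {c , d} b≈0 d≈0 = R.begin
    a R.* d R.+ b R.* c     R.≈⟨ R.+-cong (R.*-cong R.refl d≈0) (R.*-cong b≈0 R.refl) ⟩
    a R.* 0# R.+ 0# R.* c   R.≈⟨ R.+-cong (R.zeroʳ a) (R.zeroˡ c) ⟩
    0# R.+ 0#               R.≈⟨ R.+-identityʳ 0# ⟩
    0#                      R.∎

  InBase-*conj : ∀ x → InBase (x * conj x)
  InBase-*conj (a , b) = R.begin
    a R.* R.- b R.+ b R.* a   R.≈⟨ R.+-cong (R.sym (R.-‿distribʳ-* a b)) (R.*-comm b a) ⟩
    R.- (a R.* b) R.+ a R.* b  R.≈⟨ R.-‿inverseˡ (a R.* b) ⟩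
    0#                         R.∎

  conj-cong : ∀ {x y} → x ≈ y → conj x ≈ conj y
  conj-cong (p , q) = p , R.-‿cong q

  conj-involutive : ∀ x → conj (conj x) ≈ x
  conj-involutive (a , b) = R.refl , R.-‿involutive b

  conj-* : ∀ x y → conj (x * y) ≈ conj x * conj y
  conj-* (a , b) (c , d) =
      R.+-cong R.refl (R.*-cong R.refl (R.begin
        b R.* d                 R.≈⟨ R.-‿involutive (b R.* d) ⟨
        R.- (R.- (b R.* d))     R.≈⟨ R.-‿cong (R.-‿distribˡ-* b d) ⟩
        R.- (R.- b R.* d)       R.≈⟨ R.-‿distribʳ-* (R.- b) d ⟩
        R.- b R.* R.- d         R.∎))
    , (R.begin
        R.- (a R.* d R.+ b R.* c)         R.≈⟨ R.-‿anti-homo-+ (a R.* d) (b R.* c) ⟩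
        R.- (b R.* c) R.+ R.- (a R.* d)   R.≈⟨ R.+-comm _ _ ⟩
        R.- (a R.* d) R.+ R.- (b R.* c)   R.≈⟨ R.+-cong (R.-‿distribʳ-* a d) (R.-‿distribˡ-* b c) ⟩
        a R.* R.- d R.+ R.- b R.* c       R.∎)

  private
    module F where
      open CommutativeRing commutativeRing public using (_-_; setoid; commutativeSemiring; refl; sym)
      open RingProperties (CommutativeRing.ring commutativeRing) public using (-‿distribʳ-*; [y-z]x≈yx-zx)
      open import Relation.Binary.Reasoning.Setoid setoid public
    module FS = NaturalSolver F.commutativeSemiring

  -- For y ≉ 0 this says that x / y lies in the base ring.
  RatioInBase : Carrier → Carrier → Set ℓ
  RatioInBase x y = InBase (x * conj y)

  RatioInBase-cong : ∀ {x x′ y y′} → x ≈ x′ → y ≈ y′ → RatioInBase x y → RatioInBase x′ y′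
  RatioInBase-cong x≈x′ y≈y′ = InBase-cong (*-cong x≈x′ (conj-cong y≈y′))

  RatioInBase-sym : ∀ {x y} → RatioInBase x y → RatioInBase y x
  RatioInBase-sym {x} {y} p = InBase-cong (F.begin
    conj (x * conj y)             F.≈⟨ conj-* x (conj y) ⟩
    conj x * conj (conj y)        F.≈⟨ *-cong F.refl (conj-involutive y) ⟩
    conj x * y                    F.≈⟨ *-comm (conj x) y ⟩
    y * conj x                    F.∎) (InBase-conj {x * conj y} p)

  RatioInBase-sub : ∀ {x y} → RatioInBase x y → RatioInBase (x F.- y) y
  RatioInBase-sub {x} {y} p =
    InBase-cong (F.sym (F.[y-z]x≈yx-zx (conj y) x y)) (InBase-+ {x * conj y} { - (y * conj y)} p (InBase-neg {y * conj y} (InBase-*conj y)))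

  RatioInBase-negʳ : ∀ {x y} → RatioInBase x y → RatioInBase x (- y)
  RatioInBase-negʳ {x} {y} p = InBase-cong (F.-‿distribʳ-* x (conj y)) (InBase-neg {x * conj y} p)

  RatioInBase-div : ∀ {x y x′ y′} → RatioInBase x y → RatioInBase x′ y′ → RatioInBase (x′ * y) (y′ * x)
  RatioInBase-div {x} {y} {x′} {y′} p q = InBase-cong (F.begin
    x′ * conj y′ * (y * conj x)   F.≈⟨ FS.solve 4 (λ x′ cy′ y cx → x′ FS.:* cy′ FS.:* (y FS.:* cx) FS.:= x′ FS.:* y FS.:* (cy′ FS.:* cx)) F.refl x′ (conj y′) y (conj x) ⟩
    x′ * y * (conj y′ * conj x)   F.≈⟨ *-cong F.refl (conj-* y′ x) ⟨
    x′ * y * conj (y′ * x)        F.∎) (InBase-* {x′ * conj y′} q (RatioInBase-sym {x} p))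

  NoZeroDivisors : Set (c ⊔ ℓ)
  NoZeroDivisors = ∀ {a b} → a R.* b R.≈ 0# → a R.≈ 0# ⊎ b R.≈ 0#

  Anisotropic : Set (c ⊔ ℓ)
  Anisotropic = ∀ {a b} → a R.* a R.≈ δ R.* (b R.* b) → a R.≈ 0# × b R.≈ 0#

  module _ (noZeroDivisors : NoZeroDivisors) (anisotropic : Anisotropic) where

    InBase-cancelˡ : ∀ {k x} → InBase k → ¬ k ≈ 0ₑ → InBase (k * x) → InBase x
    InBase-cancelˡ {a , b} {c , d} b≈0 k≉0 kx∈ with noZeroDivisors ad≈0
      where
      ad≈0 : a R.* d R.≈ 0#
      ad≈0 = R.begin
        a R.* d                  R.≈⟨ R.+-identityʳ (a R.* d) ⟨
        a R.* d R.+ 0#           R.≈⟨ R.+-cong R.refl (R.zeroˡ c) ⟨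
        a R.* d R.+ 0# R.* c     R.≈⟨ R.+-cong R.refl (R.*-cong b≈0 R.refl) ⟨
        a R.* d R.+ b R.* c      R.≈⟨ kx∈ ⟩
        0#                       R.∎
    ... | inj₁ a≈0 = ⊥-elim (k≉0 (a≈0 , b≈0))
    ... | inj₂ d≈0 = d≈0

    *conj-nonzero : ∀ {x} → ¬ x ≈ 0ₑ → ¬ x * conj x ≈ 0ₑ
    *conj-nonzero {a , b} x≉0 (N≈0 , _) = x≉0 (anisotropic (R.begin
      a R.* a                                          R.≈⟨ R.+-identityʳ (a R.* a) ⟨
      a R.* a R.+ 0#                                   R.≈⟨ R.+-cong R.refl (R.-‿inverseˡ (δ R.* (b R.* b))) ⟨
      a R.* a R.+ (R.- (δ R.* (b R.* b)) R.+ δ R.* (b R.* b))  R.≈⟨ R.+-assoc _ _ _ ⟨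
      a R.* a R.+ R.- (δ R.* (b R.* b)) R.+ δ R.* (b R.* b)    R.≈⟨ R.+-cong (R.+-cong R.refl δ[b-b]) R.refl ⟩
      a R.* a R.+ δ R.* (b R.* R.- b) R.+ δ R.* (b R.* b)      R.≈⟨ R.+-cong N≈0 R.refl ⟩
      0# R.+ δ R.* (b R.* b)                           R.≈⟨ R.+-identityˡ _ ⟩
      δ R.* (b R.* b)                                  R.∎))
      where
      δ[b-b] : R.- (δ R.* (b R.* b)) R.≈ δ R.* (b R.* R.- b)
      δ[b-b] = R.trans (R.-‿distribʳ-* δ (b R.* b)) (R.*-cong R.refl (R.-‿distribʳ-* b b))

    RatioInBase-cancelˡ : ∀ {z x y} → ¬ z ≈ 0ₑ → RatioInBase (z * x) (z * y) → RatioInBase x y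
    RatioInBase-cancelˡ {z} {x} {y} z≉0 p =
      InBase-cancelˡ {z * conj z} (InBase-*conj z) (*conj-nonzero z≉0) (InBase-cong (F.begin
        z * x * conj (z * y)            F.≈⟨ *-cong F.refl (conj-* z y) ⟩
        z * x * (conj z * conj y)       F.≈⟨ FS.solve 4 (λ z x cz cy → z FS.:* x FS.:* (cz FS.:* cy) FS.:= z FS.:* cz FS.:* (x FS.:* cy)) F.refl z x (conj z) (conj y) ⟩
        z * conj z * (x * conj y)       F.∎) p)

-- Determinants

module Determinant {c ℓ} (R : CommutativeRing c ℓ) where
  open CommutativeRing R renaming (Carrier to A; refl to ≈-refl) hiding (sym; trans)
  open RingProperties ring using (-‿distribˡ-*; -‿distribʳ-*; ⁻¹-anti-homo‿-; -‿+-comm; +-cancelʳ; x[y-z]≈xy-xz; [y-z]x≈yx-zx)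
  open import Relation.Binary.Reasoning.Setoid setoid
  open NaturalSolver commutativeSemiring using (solve; _:=_; _:+_; _:*_)

  det : A × A → A × A → A
  det (u₁ , u₂) (v₁ , v₂) = u₁ * v₂ - u₂ * v₁

  det-antisym : ∀ u v → det u v ≈ - det v u
  det-antisym (u₁ , u₂) (v₁ , v₂) = begin
    u₁ * v₂ - u₂ * v₁       ≈⟨ +-cong (*-comm u₁ v₂) (-‿cong (*-comm u₂ v₁)) ⟩
    v₂ * u₁ - v₁ * u₂       ≈⟨ ⁻¹-anti-homo‿- (v₁ * u₂) (v₂ * u₁) ⟨
    - (v₁ * u₂ - v₂ * u₁)   ∎

  private
    [p-q]-[r-s]≈[p+s]-[q+r] : ∀ p q r s → (p - q) - (r - s) ≈ (p + s) - (q + r)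
    [p-q]-[r-s]≈[p+s]-[q+r] p q r s = begin
      (p - q) - (r - s)         ≈⟨ +-cong ≈-refl (⁻¹-anti-homo‿- r s) ⟩
      (p - q) + (s - r)         ≈⟨ solve 4 (λ p q′ s r′ → (p :+ q′) :+ (s :+ r′) := (p :+ s) :+ (q′ :+ r′)) ≈-refl p (- q) s (- r) ⟩
      (p + s) + (- q - r)       ≈⟨ +-cong ≈-refl (-‿+-comm q r) ⟩
      (p + s) - (q + r)         ∎

    [a-b][c-d]≈[ac+bd]-[ad+bc] : ∀ a b c d → (a - b) * (c - d) ≈ (a * c + b * d) - (a * d + b * c)
    [a-b][c-d]≈[ac+bd]-[ad+bc] a b c d = begin
      (a - b) * (c - d)                   ≈⟨ x[y-z]≈xy-xz (a - b) c d ⟩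
      (a - b) * c - (a - b) * d           ≈⟨ +-cong ([y-z]x≈yx-zx c a b) (-‿cong ([y-z]x≈yx-zx d a b)) ⟩
      (a * c - b * c) - (a * d - b * d)   ≈⟨ [p-q]-[r-s]≈[p+s]-[q+r] (a * c) (b * c) (a * d) (b * d) ⟩
      (a * c + b * d) - (b * c + a * d)   ≈⟨ +-cong ≈-refl (-‿cong (+-comm (b * c) (a * d))) ⟩
      (a * c + b * d) - (a * d + b * c)   ∎

    x+y′≈x′+y⇒x-y≈x′-y′ : ∀ {x y x′ y′} → x + y′ ≈ x′ + y → x - y ≈ x′ - y′
    x+y′≈x′+y⇒x-y≈x′-y′ {x} {y} {x′} {y′} eq = +-cancelʳ (y + y′) (x - y) (x′ - y′) (begin
      (x - y) + (y + y′)        ≈⟨ shuffle x y y′ ⟩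
      (x + y′) + (- y + y)      ≈⟨ +-cong eq (-‿inverseˡ y) ⟩
      (x′ + y) + 0#             ≈⟨ +-cong ≈-refl (-‿inverseˡ y′) ⟨
      (x′ + y) + (- y′ + y′)    ≈⟨ shuffle x′ y′ y ⟨
      (x′ - y′) + (y′ + y)      ≈⟨ +-cong ≈-refl (+-comm y′ y) ⟩
      (x′ - y′) + (y + y′)      ∎)
      where
      shuffle : ∀ u v w → (u - v) + (v + w) ≈ (u + w) + (- v + v)
      shuffle u v w = solve 4 (λ u v′ v w → (u :+ v′) :+ (v :+ w) := (u :+ w) :+ (v′ :+ v)) ≈-refl u (- v) v w

  -- After expanding the determinants both sides are differences of sums of monomials, and
  -- x+y′≈x′+y⇒x-y≈x′-y′ reduces their equality to an identity without negation.
  plücker : ∀ a b c d → det a b * det c d ≈ det a c * det b d - det a d * det b c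
  plücker (a₁ , a₂) (b₁ , b₂) (c₁ , c₂) (d₁ , d₂) = begin
    (a₁ * b₂ - a₂ * b₁) * (c₁ * d₂ - c₂ * d₁)
      ≈⟨ [a-b][c-d]≈[ac+bd]-[ad+bc] _ _ _ _ ⟩
    (ab₁₂ * cd₁₂ + ab₂₁ * cd₂₁) - (ab₁₂ * cd₂₁ + ab₂₁ * cd₁₂)
      ≈⟨ x+y′≈x′+y⇒x-y≈x′-y′ (solve 8 (λ a₁ a₂ b₁ b₂ c₁ c₂ d₁ d₂ →
            (a₁ :* b₂ :* (c₁ :* d₂) :+ a₂ :* b₁ :* (c₂ :* d₁))
              :+ (a₁ :* c₂ :* (b₂ :* d₁) :+ a₂ :* c₁ :* (b₁ :* d₂) :+ (a₁ :* d₂ :* (b₁ :* c₂) :+ a₂ :* d₁ :* (b₂ :* c₁)))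
            := (a₁ :* c₂ :* (b₁ :* d₂) :+ a₂ :* c₁ :* (b₂ :* d₁) :+ (a₁ :* d₂ :* (b₂ :* c₁) :+ a₂ :* d₁ :* (b₁ :* c₂)))
              :+ (a₁ :* b₂ :* (c₂ :* d₁) :+ a₂ :* b₁ :* (c₁ :* d₂))) ≈-refl a₁ a₂ b₁ b₂ c₁ c₂ d₁ d₂) ⟩
    (ac₁₂ * bd₁₂ + ac₂₁ * bd₂₁ + (ad₁₂ * bc₂₁ + ad₂₁ * bc₁₂))
      - (ac₁₂ * bd₂₁ + ac₂₁ * bd₁₂ + (ad₁₂ * bc₁₂ + ad₂₁ * bc₂₁))
      ≈⟨ [p-q]-[r-s]≈[p+s]-[q+r] _ _ _ _ ⟨
    ((ac₁₂ * bd₁₂ + ac₂₁ * bd₂₁) - (ac₁₂ * bd₂₁ + ac₂₁ * bd₁₂))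
      - ((ad₁₂ * bc₁₂ + ad₂₁ * bc₂₁) - (ad₁₂ * bc₂₁ + ad₂₁ * bc₁₂))
      ≈⟨ +-cong ([a-b][c-d]≈[ac+bd]-[ad+bc] _ _ _ _) (-‿cong ([a-b][c-d]≈[ac+bd]-[ad+bc] _ _ _ _)) ⟨
    (a₁ * c₂ - a₂ * c₁) * (b₁ * d₂ - b₂ * d₁) - (a₁ * d₂ - a₂ * d₁) * (b₁ * c₂ - b₂ * c₁)
      ∎
    where
    ab₁₂ ab₂₁ cd₁₂ cd₂₁ ac₁₂ ac₂₁ bd₁₂ bd₂₁ ad₁₂ ad₂₁ bc₁₂ bc₂₁ : A
    ab₁₂ = a₁ * b₂
    ab₂₁ = a₂ * b₁
    cd₁₂ = c₁ * d₂
    cd₂₁ = c₂ * d₁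
    ac₁₂ = a₁ * c₂
    ac₂₁ = a₂ * c₁
    bd₁₂ = b₁ * d₂
    bd₂₁ = b₂ * d₁
    ad₁₂ = a₁ * d₂
    ad₂₁ = a₂ * d₁
    bc₁₂ = b₁ * c₂
    bc₂₁ = b₂ * c₁

module _ {a p} {A : Set a} {n : ℕ} (P : (Fin n → A) → Set p)
         (P-resp : ∀ {f g} → f ≗ g → P f → P g)
         (P-transpose : ∀ i j {f} → P f → P (f ∘ (transpose i j ⟨$⟩ʳ_)))
         where

  permute : ∀ (π : Permutation′ n) {f} → P f → P (f ∘ (π ⟨$⟩ʳ_))
  permute π {f} Pf = P-resp (cong f ∘ eval-decompose π) (permute-eval (decompose π) Pf)
    where
    permute-eval : ∀ (ts : TranspositionList n) {f} → P f → P (f ∘ (eval ts ⟨$⟩ʳ_))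
    permute-eval []             Pf = Pf
    permute-eval ((i , j) ∷ ts) Pf = P-transpose i j (permute-eval ts Pf)

-- Concyclic points

module Concyclicity {c ℓ} (R : CommutativeRing c ℓ) (δ : CommutativeRing.Carrier R)
  (noZeroDivisors : QuadraticExtension.NoZeroDivisors R δ)
  (anisotropic : QuadraticExtension.Anisotropic R δ)
  where

  open QuadraticExtension R δ
  open Determinant commutativeRing
  private
    module F where
      open CommutativeRing commutativeRing public
      open RingProperties ring public using (-‿distribʳ-*)
      open import Relation.Binary.Reasoning.Setoid setoid public
    module FS = NaturalSolver F.commutativeSemiring

  Point : Set c
  Point = Carrier × Carrier

  -- The cross-ratio (det a c · det b d) / (det a d · det b c) lies in the base ring, i.e. the four points
  -- lie on a common circle.  A record, so that unification never unfolds it.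
  record Concyclic (a b c d : Point) : Set ℓ where
    constructor concyclic
    field cross-ratio-in-base : RatioInBase (det a c * det b d) (det a d * det b c)

  concyclic-swap₁₂ : ∀ {a b c d} → Concyclic a b c d → Concyclic b a c d
  concyclic-swap₁₂ {a} {b} {c} {d} (concyclic h) =
    concyclic (RatioInBase-cong (F.*-comm (det a d) (det b c)) (F.*-comm (det a c) (det b d)) (RatioInBase-sym h))

  concyclic-swap₃₄ : ∀ {a b c d} → Concyclic a b c d → Concyclic a b d c
  concyclic-swap₃₄ (concyclic h) = concyclic (RatioInBase-sym h)

  concyclic-swap₂₃ : ∀ {a b c d} → Concyclic a b c d → Concyclic a c b d
  concyclic-swap₂₃ {a} {b} {c} {d} (concyclic h) = concyclic (
    RatioInBase-cong (F.sym (plücker a b c d)) -[ad·bc]≈ad·cb (RatioInBase-negʳ (RatioInBase-sub h)))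
    where
    -[ad·bc]≈ad·cb : - (det a d * det b c) ≈ det a d * det c b
    -[ad·bc]≈ad·cb = F.trans (F.-‿distribʳ-* (det a d) (det b c)) (F.*-cong F.refl (F.sym (det-antisym c b)))

  -- Dividing the cross-ratios of a, b, c, e and of a, b, c, d leaves that of a, b, d, e, times factors
  -- det a c and det b c that cancel.
  steiner : ∀ {a b c d e} → ¬ det a c ≈ 0ₑ → ¬ det b c ≈ 0ₑ →
            Concyclic a b c d → Concyclic a b c e → Concyclic a b d e
  steiner {a} {b} {c} {d} {e} ac≉0 bc≉0 (concyclic abcd) (concyclic abce) = concyclic (
    RatioInBase-cancelˡ noZeroDivisors anisotropic bc≉0
      (RatioInBase-cancelˡ noZeroDivisors anisotropic ac≉0
        (RatioInBase-cong (FS.solve 4 (λ ac bc x y → ac FS.:* x FS.:* (y FS.:* bc) FS.:= ac FS.:* (bc FS.:* (y FS.:* x))) F.refl (det a c) (det b c) (det b e) (det a d))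
                          (FS.solve 4 (λ ac bc x y → x FS.:* bc FS.:* (ac FS.:* y) FS.:= ac FS.:* (bc FS.:* (x FS.:* y))) F.refl (det a c) (det b c) (det a e) (det b d))
          (RatioInBase-div abcd abce))))

  concyclic-rotate : ∀ {a b c d} → Concyclic a b c d → Concyclic b c a d
  concyclic-rotate = concyclic-swap₂₃ ∘ concyclic-swap₁₂

  Concyclic-cong : ∀ {a a′ b b′ c c′ d d′} → a ≡ a′ → b ≡ b′ → c ≡ c′ → d ≡ d′ →
                   Concyclic a b c d → Concyclic a′ b′ c′ d′
  Concyclic-cong refl refl refl refl = id

  Concyclic⁴ : (Fin 4 → Point) → Set ℓ
  Concyclic⁴ f = Concyclic (f 0F) (f 1F) (f 2F) (f 3F)

  Concyclic⁴-resp : ∀ {f g} → f ≗ g → Concyclic⁴ f → Concyclic⁴ g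
  Concyclic⁴-resp f≗g = Concyclic-cong (f≗g 0F) (f≗g 1F) (f≗g 2F) (f≗g 3F)

  concyclic-transpose : ∀ i j {f} → Concyclic⁴ f → Concyclic⁴ (f ∘ (transpose i j ⟨$⟩ʳ_))
  concyclic-transpose 0F 0F = id
  concyclic-transpose 1F 1F = id
  concyclic-transpose 2F 2F = id
  concyclic-transpose 3F 3F = id
  concyclic-transpose 0F 1F = concyclic-swap₁₂
  concyclic-transpose 1F 0F = concyclic-swap₁₂
  concyclic-transpose 1F 2F = concyclic-swap₂₃
  concyclic-transpose 2F 1F = concyclic-swap₂₃
  concyclic-transpose 2F 3F = concyclic-swap₃₄
  concyclic-transpose 3F 2F = concyclic-swap₃₄
  concyclic-transpose 0F 2F = concyclic-swap₁₂ ∘ concyclic-swap₂₃ ∘ concyclic-swap₁₂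
  concyclic-transpose 2F 0F = concyclic-swap₁₂ ∘ concyclic-swap₂₃ ∘ concyclic-swap₁₂
  concyclic-transpose 1F 3F = concyclic-swap₂₃ ∘ concyclic-swap₃₄ ∘ concyclic-swap₂₃
  concyclic-transpose 3F 1F = concyclic-swap₂₃ ∘ concyclic-swap₃₄ ∘ concyclic-swap₂₃
  concyclic-transpose 0F 3F = concyclic-swap₁₂ ∘ concyclic-swap₂₃ ∘ concyclic-swap₃₄ ∘ concyclic-swap₂₃ ∘ concyclic-swap₁₂
  concyclic-transpose 3F 0F = concyclic-swap₁₂ ∘ concyclic-swap₂₃ ∘ concyclic-swap₃₄ ∘ concyclic-swap₂₃ ∘ concyclic-swap₁₂

  concyclic-permute : ∀ (π : Permutation′ 4) {f} → Concyclic⁴ f → Concyclic⁴ (f ∘ (π ⟨$⟩ʳ_))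
  concyclic-permute = permute Concyclic⁴ Concyclic⁴-resp concyclic-transpose

  concyclic-unpermute : ∀ (π : Permutation′ 4) {f} → Concyclic⁴ (f ∘ (π ⟨$⟩ʳ_)) → Concyclic⁴ f
  concyclic-unpermute π {f} = Concyclic⁴-resp (λ i → cong f (inverseʳ π {i})) ∘ concyclic-permute (flip π) {f ∘ (π ⟨$⟩ʳ_)}

  Nondegenerate : ∀ {k} → (Fin k → Point) → Set ℓ
  Nondegenerate f = ∀ {i j} → i ≢ j → ¬ det (f i) (f j) ≈ 0ₑ

  ConcyclicWithout : (Fin 5 → Point) → Fin 5 → Set ℓ
  ConcyclicWithout f i = Concyclic⁴ (f ∘ punchIn i)

  module _ (π : Permutation′ 5) {f : Fin 5 → Point} where

    private
      punchIn-permute-≗ : ∀ i → (f ∘ (π ⟨$⟩ʳ_)) ∘ punchIn i ≗ (f ∘ punchIn (π ⟨$⟩ʳ i)) ∘ (Permutation.remove i π ⟨$⟩ʳ_)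
      punchIn-permute-≗ i j = cong f (punchIn-permute π i j)

    without-permute : ∀ {i} → ConcyclicWithout f (π ⟨$⟩ʳ i) → ConcyclicWithout (f ∘ (π ⟨$⟩ʳ_)) i
    without-permute {i} = Concyclic⁴-resp (sym ∘ punchIn-permute-≗ i) ∘ concyclic-permute (Permutation.remove i π) {f ∘ punchIn (π ⟨$⟩ʳ i)}

    without-unpermute : ∀ {i} → ConcyclicWithout (f ∘ (π ⟨$⟩ʳ_)) i → ConcyclicWithout f (π ⟨$⟩ʳ i)
    without-unpermute {i} = concyclic-unpermute (Permutation.remove i π) {f ∘ punchIn (π ⟨$⟩ʳ i)} ∘ Concyclic⁴-resp (punchIn-permute-≗ i)

    nondegenerate-permute : Nondegenerate f → Nondegenerate (f ∘ (π ⟨$⟩ʳ_))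
    nondegenerate-permute nd {i} {j} i≢j = nd (λ πi≡πj → i≢j (trans (sym (inverseˡ π {i})) (trans (cong (π ⟨$⟩ˡ_) πi≡πj) (inverseˡ π {j}))))

  steiner-spread : ∀ {f} → Nondegenerate f → ConcyclicWithout f 4F → ConcyclicWithout f 3F →
                   ∀ k → k ≢ 3F → k ≢ 4F → ConcyclicWithout f k
  steiner-spread nd h₄ h₃ 0F _ _ = steiner (nd λ ()) (nd λ ()) (concyclic-rotate h₄) (concyclic-rotate h₃)
  steiner-spread nd h₄ h₃ 1F _ _ = steiner (nd λ ()) (nd λ ()) (concyclic-swap₂₃ h₄) (concyclic-swap₂₃ h₃)
  steiner-spread nd h₄ h₃ 2F _ _ = steiner (nd λ ()) (nd λ ()) h₄ h₃
  steiner-spread nd h₄ h₃ 3F k≢3 _ = ⊥-elim (k≢3 refl)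
  steiner-spread nd h₄ h₃ 4F _ k≢4 = ⊥-elim (k≢4 refl)

  private
    pivot : Fin 5 → Fin 5 → Permutation′ 5
    pivot i j = transpose 3F (transpose i 4F ⟨$⟩ʳ j) ∘ₚ transpose 4F i

    pivot-correct : ∀ i j → i ≢ j → pivot i j ⟨$⟩ʳ 4F ≡ i × pivot i j ⟨$⟩ʳ 3F ≡ j
    pivot-correct = toWitness {a? = all? λ i → all? λ j → ¬? (i ≟ j) →-dec (pivot i j ⟨$⟩ʳ 4F ≟ i ×-dec pivot i j ⟨$⟩ʳ 3F ≟ j)} _

  -- Relabel the five points so that i and j become 4 and 3, and spread from there.
  five-point : ∀ {f} → Nondegenerate f → ∀ {i j k} → i ≢ j → k ≢ i → k ≢ j →
               ConcyclicWithout f i → ConcyclicWithout f j → ConcyclicWithout f k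
  five-point {f} nd {i} {j} {k} i≢j k≢i k≢j hᵢ hⱼ =
    subst (ConcyclicWithout f) (inverseʳ π) (without-unpermute π {f} {m} (steiner-spread (nondegenerate-permute π {f} nd) h₄ h₃ m m≢3 m≢4))
    where
    π : Permutation′ 5
    π = pivot i j
    m : Fin 5
    m = π ⟨$⟩ˡ k
    π4≡i : π ⟨$⟩ʳ 4F ≡ i
    π4≡i = proj₁ (pivot-correct i j i≢j)
    π3≡j : π ⟨$⟩ʳ 3F ≡ j
    π3≡j = proj₂ (pivot-correct i j i≢j)
    h₄ : ConcyclicWithout (f ∘ (π ⟨$⟩ʳ_)) 4F
    h₄ = without-permute π {f} {4F} (subst (ConcyclicWithout f) (sym π4≡i) hᵢ)
    h₃ : ConcyclicWithout (f ∘ (π ⟨$⟩ʳ_)) 3F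
    h₃ = without-permute π {f} {3F} (subst (ConcyclicWithout f) (sym π3≡j) hⱼ)
    m≢3 : m ≢ 3F
    m≢3 m≡3 = k≢j (trans (sym (inverseʳ π)) (trans (cong (π ⟨$⟩ʳ_) m≡3) π3≡j))
    m≢4 : m ≢ 4F
    m≢4 m≡4 = k≢i (trans (sym (inverseʳ π)) (trans (cong (π ⟨$⟩ʳ_) m≡4) π4≡i))

-- Subsets as sorted lists

delete : ∀ {n} → Subset n → Fin n → Subset n
delete (_ ∷ p) fzero    = outside ∷ p
delete (b ∷ p) (fsuc x) = b ∷ delete p x

zipWith-⁅⁆ : ∀ {n} {f : Side → Side → Side} → (∀ b → f b inside ≡ outside) → (∀ b → f b outside ≡ b) →
             ∀ (p : Subset n) x → zipWith f p ⁅ x ⁆ ≡ delete p x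
zipWith-⁅⁆ fᵢ fₒ (b ∷ p) fzero    = cong₂ _∷_ (fᵢ b) (zipWith-identityʳ fₒ p)
zipWith-⁅⁆ fᵢ fₒ (b ∷ p) (fsuc x) = cong₂ _∷_ (fₒ b) (zipWith-⁅⁆ fᵢ fₒ p x)

∖≡delete : ∀ {n} (p : Subset n) x → p ∖ x ≡ delete p x
∖≡delete p x = zipWith-⁅⁆ (λ _ → refl) (λ _ → refl) p x

∣p∣≡0⇒p≡∅ : ∀ {n} (p : Subset n) → ∣ p ∣ ≡ 0 → p ≡ ∅
∣p∣≡0⇒p≡∅ []            _      = refl
∣p∣≡0⇒p≡∅ (outside ∷ p) ∣p∣≡0 = cong (outside ∷_) (∣p∣≡0⇒p≡∅ p ∣p∣≡0)

delete-singleton : ∀ {n} {r : Subset n} {j} → j ∈ r → ∣ r ∣ ≡ 1 → delete r j ≡ ∅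
delete-singleton {r = inside ∷ r}  here         ∣r∣≡1 = cong (outside ∷_) (∣p∣≡0⇒p≡∅ r (suc-injective ∣r∣≡1))
delete-singleton {r = inside ∷ r}  (there j∈r) ∣r∣≡1 = ⊥-elim (∉∅ (subst (_ ∈_) (∣p∣≡0⇒p≡∅ r (suc-injective ∣r∣≡1)) j∈r))
delete-singleton {r = outside ∷ r} (there j∈r) ∣r∣≡1 = cong (outside ∷_) (delete-singleton j∈r ∣r∣≡1)

-- Natural numbers rather than elements of Fin n keep the evaluation of `covered` below in builtin
-- arithmetic.
elements : ∀ {n} → Subset n → List ℕ
elements []            = []
elements (inside ∷ p)  = 0 ∷ map suc (elements p)
elements (outside ∷ p) = map suc (elements p)

length-elements : ∀ {n} (p : Subset n) → length (elements p) ≡ ∣ p ∣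
length-elements []            = refl
length-elements (inside ∷ p)  = cong suc (trans (length-map suc (elements p)) (length-elements p))
length-elements (outside ∷ p) = trans (length-map suc (elements p)) (length-elements p)

elements-bounded : ∀ {n} (p : Subset n) → All (_< n) (elements p)
elements-bounded []            = []
elements-bounded (inside ∷ p)  = z<s ∷ All.map⁺ (All.map s<s (elements-bounded p))
elements-bounded (outside ∷ p) = All.map⁺ (All.map s<s (elements-bounded p))

elements-sorted : ∀ {n} (p : Subset n) → AllPairs _<_ (elements p)
elements-sorted []            = []
elements-sorted (inside ∷ p)  = All.map⁺ (All.universal (λ _ → z<s) (elements p)) ∷ AllPairs.map⁺ (AllPairs.map s<s (elements-sorted p))
elements-sorted (outside ∷ p) = AllPairs.map⁺ (AllPairs.map s<s (elements-sorted p))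

∈-elements : ∀ {n} {x : Fin n} {p} → x ∈ p → toℕ x ∈ₗ elements p
∈-elements {p = inside ∷ p}  here       = here refl
∈-elements {p = inside ∷ p}  (there x∈p) = there (∈-map⁺ suc (∈-elements x∈p))
∈-elements {p = outside ∷ p} (there x∈p) = ∈-map⁺ suc (∈-elements x∈p)

insert : ℕ → List ℕ → List ℕ
insert x []       = x ∷ []
insert x (y ∷ ys) = if x <ᵇ y then x ∷ y ∷ ys else y ∷ insert x ys

remove : ℕ → List ℕ → List ℕ
remove x []       = []
remove x (y ∷ ys) = if x ≡ᵇ y then ys else y ∷ remove x ys

private
  insert-0 : ∀ ys → insert 0 (map suc ys) ≡ 0 ∷ map suc ys
  insert-0 []       = refl
  insert-0 (y ∷ ys) = refl

  insert-suc : ∀ x ys → insert (suc x) (map suc ys) ≡ map suc (insert x ys)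
  insert-suc x []       = refl
  insert-suc x (y ∷ ys) with x <ᵇ y
  ... | true  = refl
  ... | false = cong (suc y ∷_) (insert-suc x ys)

  remove-0 : ∀ ys → remove 0 (map suc ys) ≡ map suc ys
  remove-0 []       = refl
  remove-0 (y ∷ ys) = cong (suc y ∷_) (remove-0 ys)

  remove-suc : ∀ x ys → remove (suc x) (map suc ys) ≡ map suc (remove x ys)
  remove-suc x []       = refl
  remove-suc x (y ∷ ys) with x ≡ᵇ y
  ... | true  = refl
  ... | false = cong (suc y ∷_) (remove-suc x ys)

elements-∪ : ∀ {n} {x : Fin n} {p} → x ∉ p → elements (p ∪ ⁅ x ⁆) ≡ insert (toℕ x) (elements p)
elements-∪ {x = fzero}  {inside ∷ p}  x∉p = ⊥-elim (x∉p here)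
elements-∪ {x = fzero}  {outside ∷ p} _   rewrite ∪-identityʳ p = sym (insert-0 (elements p))
elements-∪ {x = fsuc x} {inside ∷ p}  x∉p = cong (0 ∷_) (trans (cong (map suc) (elements-∪ (x∉p ∘ there))) (sym (insert-suc (toℕ x) (elements p))))
elements-∪ {x = fsuc x} {outside ∷ p} x∉p = trans (cong (map suc) (elements-∪ (x∉p ∘ there))) (sym (insert-suc (toℕ x) (elements p)))

elements-delete : ∀ {n} (p : Subset n) (x : Fin n) → elements (delete p x) ≡ remove (toℕ x) (elements p)
elements-delete (inside ∷ p)  fzero    = refl
elements-delete (outside ∷ p) fzero    = sym (remove-0 (elements p))
elements-delete (inside ∷ p)  (fsuc x) = cong (0 ∷_) (trans (cong (map suc) (elements-delete p x)) (sym (remove-suc (toℕ x) (elements p))))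
elements-delete (outside ∷ p) (fsuc x) = trans (cong (map suc) (elements-delete p x)) (sym (remove-suc (toℕ x) (elements p)))

lookup-sorted : ∀ {xs} → AllPairs _<_ xs → ∀ {i j} → i Fin.< j → lookup xs i < lookup xs j
lookup-sorted (x<xs ∷ _)  {fzero}  {fsuc j} _         = All.lookup x<xs (∈-lookup j)
lookup-sorted (_ ∷ sorted) {fsuc i} {fsuc j} (s<s i<j) = lookup-sorted sorted i<j

lookup-injective : ∀ {xs} → AllPairs _<_ xs → ∀ {i j} → lookup xs i ≡ lookup xs j → i ≡ j
lookup-injective sorted {i} {j} eq with <-cmp i j
... | tri< i<j _ _ = ⊥-elim (<⇒≢ (lookup-sorted sorted i<j) eq)
... | tri≈ _ i≡j _ = i≡j
... | tri> _ _ j<i = ⊥-elim (<⇒≢ (lookup-sorted sorted j<i) (sym eq))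

remove-lookup : ∀ {xs} → AllPairs _<_ xs → ∀ i → remove (lookup xs i) xs ≡ removeAt xs i
remove-lookup {x ∷ xs} _ fzero with x ≡ᵇ x | ≡⇒≡ᵇ x x refl
... | true | _ = refl
remove-lookup {x ∷ xs} (x<xs ∷ sorted) (fsuc i) with lookup xs i ≡ᵇ x in eq
... | true  = ⊥-elim (<⇒≢ (All.lookup x<xs (∈-lookup i)) (sym (≡ᵇ⇒≡ _ _ (subst T (sym eq) tt))))
... | false = cong (x ∷_) (remove-lookup sorted i)

-- Adding a twin vertex

third-colour : ∀ (a b : Fin 3) → ∃ λ k → k ≢ a × k ≢ b
third-colour = toWitness {a? = all? λ a → all? λ b → any? λ k → ¬? (k ≟ a) ×-dec ¬? (k ≟ b)} _

module Duplication {m : ℕ} where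

  open import Data.Nat using (_+_)

  fill : Subset (3 + m) → Subset (3 + m)
  fill (outside ∷ A)                    = inside ∷ A
  fill (inside ∷ outside ∷ A)           = inside ∷ inside ∷ A
  fill (inside ∷ inside ∷ outside ∷ A)  = inside ∷ inside ∷ inside ∷ A
  fill (inside ∷ inside ∷ inside ∷ A)   = inside ∷ inside ∷ inside ∷ A

  -- The new vertex 0 is a twin of the old vertex 0; in a set that also contains the old vertex 0 it is
  -- replaced by the first of the old vertices 1, 2 missing from the set.
  merge : Subset (4 + m) → Subset (3 + m)
  merge (outside ∷ A) = A
  merge (inside ∷ A)  = fill A

  duplicate : Colouring (3 + m) → Colouring (4 + m)
  duplicate χ A = χ (merge A)

  full : Subset m → Subset (3 + m)
  full r = inside ∷ inside ∷ inside ∷ r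

  Full : Subset (3 + m) → Set
  Full A = ∃ λ r → A ≡ full r

  Crowded : Subset (4 + m) → Set
  Crowded S = ∃ λ r → S ≡ inside ∷ full r

  crowded? : ∀ S → Crowded S ⊎ (¬ Crowded S)
  crowded? (outside ∷ _)                                = inj₂ λ ()
  crowded? (inside ∷ outside ∷ _)                       = inj₂ λ ()
  crowded? (inside ∷ inside ∷ outside ∷ _)              = inj₂ λ ()
  crowded? (inside ∷ inside ∷ inside ∷ outside ∷ _)     = inj₂ λ ()
  crowded? (inside ∷ inside ∷ inside ∷ inside ∷ r)      = inj₁ (r , refl)

  ∣merge∣ : ∀ S → ¬ Crowded S → ∣ merge S ∣ ≡ ∣ S ∣
  ∣merge∣ (outside ∷ _)                             _         = refl
  ∣merge∣ (inside ∷ outside ∷ _)                    _         = refl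
  ∣merge∣ (inside ∷ inside ∷ outside ∷ _)           _         = refl
  ∣merge∣ (inside ∷ inside ∷ inside ∷ outside ∷ _)  _         = refl
  ∣merge∣ (inside ∷ inside ∷ inside ∷ inside ∷ r)   ¬crowded = ⊥-elim (¬crowded (r , refl))

  ⊆-fill : ∀ {x} A → x ∈ A → x ∈ fill A
  ⊆-fill (outside ∷ _)                   (there x∈A)                 = there x∈A
  ⊆-fill (inside ∷ outside ∷ _)          here                        = here
  ⊆-fill (inside ∷ outside ∷ _)          (there (there x∈A))         = there (there x∈A)
  ⊆-fill (inside ∷ inside ∷ outside ∷ _) here                        = here
  ⊆-fill (inside ∷ inside ∷ outside ∷ _) (there here)                = there here
  ⊆-fill (inside ∷ inside ∷ outside ∷ _) (there (there (there x∈A))) = there (there (there x∈A))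
  ⊆-fill (inside ∷ inside ∷ inside ∷ _)  x∈A                         = x∈A

  fill-∪ : ∀ {x} A → x ∉ fill A → fill (A ∪ ⁅ x ⁆) ≡ fill A ∪ ⁅ x ⁆
  fill-∪ {fzero}                (outside ∷ _)                   x∉ = ⊥-elim (x∉ here)
  fill-∪ {fsuc _}               (outside ∷ _)                   _  = refl
  fill-∪ {fzero}                (inside ∷ outside ∷ _)          x∉ = ⊥-elim (x∉ here)
  fill-∪ {fsuc fzero}           (inside ∷ outside ∷ _)          x∉ = ⊥-elim (x∉ (there here))
  fill-∪ {fsuc (fsuc _)}        (inside ∷ outside ∷ _)          _  = refl
  fill-∪ {fzero}                (inside ∷ inside ∷ outside ∷ _) x∉ = ⊥-elim (x∉ here)
  fill-∪ {fsuc fzero}           (inside ∷ inside ∷ outside ∷ _) x∉ = ⊥-elim (x∉ (there here))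
  fill-∪ {fsuc (fsuc fzero)}    (inside ∷ inside ∷ outside ∷ _) x∉ = ⊥-elim (x∉ (there (there here)))
  fill-∪ {fsuc (fsuc (fsuc _))} (inside ∷ inside ∷ outside ∷ _) _  = refl
  fill-∪ {fzero}                (inside ∷ inside ∷ inside ∷ _)  x∉ = ⊥-elim (x∉ here)
  fill-∪ {fsuc fzero}           (inside ∷ inside ∷ inside ∷ _)  x∉ = ⊥-elim (x∉ (there here))
  fill-∪ {fsuc (fsuc fzero)}    (inside ∷ inside ∷ inside ∷ _)  x∉ = ⊥-elim (x∉ (there (there here)))
  fill-∪ {fsuc (fsuc (fsuc _))} (inside ∷ inside ∷ inside ∷ _)  _  = refl

  fill-slot : ∀ A → ¬ Full A → ∃ λ y → y ∈ fill A × delete (fill A) y ≡ A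
  fill-slot (outside ∷ _)                   _      = 0F , here , refl
  fill-slot (inside ∷ outside ∷ _)          _      = 1F , there here , refl
  fill-slot (inside ∷ inside ∷ outside ∷ _) _      = 2F , there (there here) , refl
  fill-slot (inside ∷ inside ∷ inside ∷ r)  ¬full = ⊥-elim (¬full (r , refl))

  fill-delete : ∀ A {x} → ¬ Full A → x ∈ A → ∃ λ y → y ∈ fill A × fill (delete A x) ≡ delete (fill A) y
  fill-delete (outside ∷ _)                   _     (there x∈A)                 = _ , there x∈A , refl
  fill-delete (inside ∷ outside ∷ _)          _     here                        = 1F , there here , refl
  fill-delete (inside ∷ outside ∷ _)          _     (there (there x∈A))         = _ , there (there x∈A) , refl
  fill-delete (inside ∷ inside ∷ outside ∷ _) _     here                        = 2F , there (there here) , refl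
  fill-delete (inside ∷ inside ∷ outside ∷ _) _     (there here)                = 2F , there (there here) , refl
  fill-delete (inside ∷ inside ∷ outside ∷ _) _     (there (there (there x∈A))) = _ , there (there (there x∈A)) , refl
  fill-delete (inside ∷ inside ∷ inside ∷ r)  ¬full _                           = ⊥-elim (¬full (r , refl))

  merge-∪ : ∀ S {x} → x ∉ merge S → fsuc x ∉ S × merge (S ∪ ⁅ fsuc x ⁆) ≡ merge S ∪ ⁅ x ⁆
  merge-∪ (outside ∷ _) x∉ = (λ { (there x∈) → x∉ x∈ }) , refl
  merge-∪ (inside ∷ A)  x∉ = (λ { (there x∈) → x∉ (⊆-fill A x∈) }) , fill-∪ A x∉

  merge-delete : ∀ S {x} → ¬ Crowded S → x ∈ S → ∃ λ y → y ∈ merge S × merge (delete S x) ≡ delete (merge S) y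
  merge-delete (outside ∷ _) _        (there x∈S) = _ , x∈S , refl
  merge-delete (inside ∷ A)  ¬crowded here        with fill-slot A (¬crowded ∘ λ (r , A≡) → r , cong (inside ∷_) A≡)
  ... | y , y∈ , A≡ = y , y∈ , sym A≡
  merge-delete (inside ∷ A)  ¬crowded (there x∈A) = fill-delete A (¬crowded ∘ λ (r , A≡) → r , cong (inside ∷_) A≡) x∈A

  crowded-delete : ∀ {r x} → x ∈ inside ∷ full r →
                   merge (delete (inside ∷ full r) x) ≡ full r ⊎ ∃ λ j → j ∈ r × merge (delete (inside ∷ full r) x) ≡ full (delete r j)
  crowded-delete here                                = inj₁ refl
  crowded-delete (there here)                        = inj₁ refl
  crowded-delete (there (there here))                = inj₁ refl
  crowded-delete (there (there (there here)))        = inj₁ refl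
  crowded-delete (there (there (there (there j∈r)))) = inj₂ (_ , j∈r , refl)

  module _ {χ : Colouring (3 + m)} where

    duplicate-covering : CoveringColouring χ → CoveringColouring (duplicate χ)
    duplicate-covering covering k T ∣T∣≡3
      with covering k (merge T) (trans (∣merge∣ T ¬crowded) ∣T∣≡3)
      where
      ¬crowded : ¬ Crowded T
      ¬crowded (r , T≡) with trans (sym (cong ∣_∣ T≡)) ∣T∣≡3
      ... | ()
    ... | x , x∉ , coloured = fsuc x , proj₁ (merge-∪ T x∉) , trans (cong χ (proj₂ (merge-∪ T x∉))) coloured

    merge-rainbow : ∀ {S} → ¬ Crowded S → Rainbow5 (duplicate χ) S → Rainbow5 χ (merge S)
    merge-rainbow {S} ¬crowded (∣S∣≡5 , rainbow) = trans (∣merge∣ S ¬crowded) ∣S∣≡5 , rainbow′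
      where
      rainbow′ : ∀ k → ∃ λ y → y ∈ merge S × χ (merge S ∖ y) ≡ k
      rainbow′ k with rainbow k
      ... | x , x∈S , coloured with merge-delete S ¬crowded x∈S
      ... | y , y∈ , merged = y , y∈ , (begin
        χ (merge S ∖ y)           ≡⟨ cong χ (∖≡delete (merge S) y) ⟩
        χ (delete (merge S) y)    ≡⟨ cong χ merged ⟨
        χ (merge (delete S x))    ≡⟨ cong (χ ∘ merge) (∖≡delete S x) ⟨
        χ (merge (S ∖ x))         ≡⟨ coloured ⟩
        k                         ∎)
        where open ≡-Reasoning

    crowded-colour : ∀ {r x} → ∣ r ∣ ≡ 1 → x ∈ inside ∷ full r →
                     duplicate χ ((inside ∷ full r) ∖ x) ≡ χ (full r) ⊎ duplicate χ ((inside ∷ full r) ∖ x) ≡ χ (full ∅)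
    crowded-colour {r} {x} ∣r∣≡1 x∈ with crowded-delete x∈
    ... | inj₁ merged             = inj₁ (trans (cong (χ ∘ merge) (∖≡delete (inside ∷ full r) x)) (cong χ merged))
    ... | inj₂ (j , j∈r , merged) = inj₂ (begin
      χ (merge ((inside ∷ full r) ∖ x))       ≡⟨ cong (χ ∘ merge) (∖≡delete (inside ∷ full r) x) ⟩
      χ (merge (delete (inside ∷ full r) x)) ≡⟨ cong χ merged ⟩
      χ (full (delete r j))                 ≡⟨ cong (χ ∘ full) (delete-singleton j∈r ∣r∣≡1) ⟩
      χ (full ∅)                            ∎)
      where open ≡-Reasoning

    crowded-not-rainbow : ∀ r → ¬ Rainbow5 (duplicate χ) (inside ∷ full r)
    crowded-not-rainbow r (∣S∣≡5 , rainbow) with third-colour (χ (full r)) (χ (full ∅))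
    ... | k , k≢₁ , k≢₂ with rainbow k
    ... | x , x∈S , coloured =
      Sum.[ k≢₁ ∘ trans (sym coloured) , k≢₂ ∘ trans (sym coloured) ] (crowded-colour ∣r∣≡1 x∈S)
      where
      ∣r∣≡1 : ∣ r ∣ ≡ 1
      ∣r∣≡1 = suc-injective (suc-injective (suc-injective (suc-injective ∣S∣≡5)))

    duplicate-no-rainbow : (∀ S → ¬ Rainbow5 χ S) → ∀ S → ¬ Rainbow5 (duplicate χ) S
    duplicate-no-rainbow no-rainbow S rainbow with crowded? S
    ... | inj₁ (r , refl) = crowded-not-rainbow r rainbow
    ... | inj₂ ¬crowded   = no-rainbow (merge S) (merge-rainbow ¬crowded rainbow)

-- A colouring of the 4-sets of 50 vertices

module ℤ/7 = Modular 7
open ℤ/7 using (mod; _≈?_; ≈-residue)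

module 𝔽₄₉ = QuadraticExtension ℤ/7.commutativeRing 3

7-prime : Prime 7
7-prime = toWitness {a? = prime? 7} _

3-anisotropic : 𝔽₄₉.Anisotropic
3-anisotropic {a} {b} aa≈3bb with check (m%n<n a 7) (m%n<n b 7) residues
  where
  open IsEquivalence ℤ/7.≈-isEquivalence renaming (refl to ≈-refl; sym to ≈-sym; trans to ≈-trans)
  open ℤ/7 using (*-cong)
  check : ∀ {r} → r < 7 → ∀ {s} → s < 7 → r ℤ/7.* r ℤ/7.≈ 3 ℤ/7.* (s ℤ/7.* s) → r ≡ 0 × s ≡ 0
  check = toWitness {a? = allUpTo? (λ r → allUpTo? (λ s → (r ℤ/7.* r ≈? 3 ℤ/7.* (s ℤ/7.* s)) →-dec (r ℕ.≟ 0 ×-dec s ℕ.≟ 0)) 7) 7} _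
  residues : a % 7 ℤ/7.* (a % 7) ℤ/7.≈ 3 ℤ/7.* (b % 7 ℤ/7.* (b % 7))
  residues = ≈-trans (*-cong (≈-sym (≈-residue a)) (≈-sym (≈-residue a)))
                     (≈-trans aa≈3bb (*-cong (≈-refl {3}) (*-cong (≈-residue b) (≈-residue b))))
... | a%7≡0 , b%7≡0 = mod a%7≡0 , mod b%7≡0

open 𝔽₄₉ using (Carrier; _≈_; _*_; _+_; -_; 0ₑ; 1ₑ; conj; InBase)
open Determinant 𝔽₄₉.commutativeRing using (det)
open Concyclicity ℤ/7.commutativeRing 3 (ℤ/7.noZeroDivisors 7-prime) 3-anisotropic

InBase? : ∀ x → Dec (InBase x)
InBase? (_ , b) = b ≈? 0

≈0? : ∀ x → Dec (x ≈ 0ₑ)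
≈0? (a , b) = a ≈? 0 ×-dec b ≈? 0

-- Vertex i < 49 is the point (i mod 7) + (i div 7)·√3 of the affine line, vertex 49 the point at infinity.
point : ℕ → Point
point i = if i <ᵇ 49 then ((i % 7 , i / 7) , 1ₑ) else (1ₑ , 0ₑ)

point-det-nonzero : ∀ {i} → i < 50 → ∀ {j} → j < 50 → i ≢ j → ¬ det (point i) (point j) ≈ 0ₑ
point-det-nonzero = toWitness {a? = allUpTo? (λ i → allUpTo? (λ j → ¬? (i ℕ.≟ j) →-dec ¬? (≈0? (det (point i) (point j)))) 50) 50} _

concyclicColour : Carrier → Fin 3
concyclicColour Q = if does (≈0? Q) then 2F else 1F

concyclicColour-≢0 : ∀ Q → concyclicColour Q ≢ 0F
concyclicColour-≢0 Q with does (≈0? Q)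
... | true  = λ ()
... | false = λ ()

-- X / Y is the cross-ratio: colour 0 unless it lies in 𝔽₇, and then colour 2 exactly if it is a root
-- of λ² − λ + 1, i.e. a primitive sixth root of unity.
classify : Carrier → Carrier → Fin 3
classify X Y with InBase? (X * conj Y)
... | no _  = 0F
... | yes _ = concyclicColour (X * X + - (X * Y) + Y * Y)

classify-0 : ∀ X Y → classify X Y ≡ 0F → ¬ InBase (X * conj Y)
classify-0 X Y c≡0 with InBase? (X * conj Y)
... | no ¬in = ¬in
... | yes _  = ⊥-elim (concyclicColour-≢0 (X * X + - (X * Y) + Y * Y) c≡0)

classify-≢0 : ∀ X Y → classify X Y ≢ 0F → InBase (X * conj Y)
classify-≢0 X Y c≢0 with InBase? (X * conj Y)
... | no _   = ⊥-elim (c≢0 refl)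
... | yes X∈ = X∈

-- Opaque, so that unification never evaluates the colour of symbolic points.
opaque
  colour : Point → Point → Point → Point → Fin 3
  colour a b c d = classify (det a c * det b d) (det a d * det b c)

  colour-0 : ∀ {a b c d} → colour a b c d ≡ 0F → ¬ Concyclic a b c d
  colour-0 {a} {b} {c} {d} c≡0 (concyclic h) = classify-0 (det a c * det b d) (det a d * det b c) c≡0 h

  colour-≢0 : ∀ {a b c d} → colour a b c d ≢ 0F → Concyclic a b c d
  colour-≢0 {a} {b} {c} {d} = concyclic ∘ classify-≢0 (det a c * det b d) (det a d * det b c)

colourL : List ℕ → Fin 3
colourL (a ∷ b ∷ c ∷ d ∷ []) = colour (point a) (point b) (point c) (point d)
colourL _ = 0F

χ₀ : Colouring 50
χ₀ A = colourL (elements A)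

-- x x̄ lies in 𝔽₇, where every nonzero element has sixth power 1.
_⁻¹ : Carrier → Carrier
x ⁻¹ = conj x * (n ℕ.* n ℕ.* n ℕ.* n ℕ.* n , 0)
  where n = proj₁ (x * conj x)

affine-vertex : Carrier → ℕ
affine-vertex (u₁ , u₂) = u₁ % 7 ℕ.+ 7 ℕ.* (u₂ % 7)

vertex : Point → ℕ
vertex (v₁ , v₂) = if does (≈0? v₂) then 49 else affine-vertex (v₁ * v₂ ⁻¹)

-- The projectivity sending 0, 1, ∞ to the points a, b, c; for t ∈ 𝔽₇ it runs through the circle of a, b, c.
circlePoint : ℕ → ℕ → ℕ → ℕ → ℕ
circlePoint a b c t = vertex (combine (point c) (point a))
  where
  λ′ μ : Carrier
  λ′ = (t , 0) * det (point b) (point a)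
  μ  = det (point c) (point b)
  combine : Point → Point → Point
  combine (u₁ , u₂) (v₁ , v₂) = (λ′ * u₁ + μ * v₁ , λ′ * u₂ + μ * v₂)

Extension : ℕ → ℕ → ℕ → Fin 3 → ℕ → Set
Extension a b c k w = w < 50 × w ≢ a × w ≢ b × w ≢ c × colourL (insert w (a ∷ b ∷ c ∷ [])) ≡ k

extension? : ∀ a b c k w → Dec (Extension a b c k w)
extension? a b c k w =
  w <? 50 ×-dec ¬? (w ℕ.≟ a) ×-dec ¬? (w ℕ.≟ b) ×-dec ¬? (w ℕ.≟ c) ×-dec colourL (insert w (a ∷ b ∷ c ∷ [])) ≟ k

-- Witnesses for colours 1 and 2 are the points with parameters 2 and 3 on the circle through a, b, c:
-- 3 is a root of λ² − λ + 1 in 𝔽₇ and 2 is not.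
Covered : ℕ → ℕ → ℕ → Set
Covered a b c = Any (Extension a b c 0F) (upTo 50)
              × Extension a b c 1F (circlePoint a b c 2) × Extension a b c 2F (circlePoint a b c 3)

covered? : ∀ a b c → Dec (Covered a b c)
covered? a b c = Any.any? (extension? a b c 0F) (upTo 50)
           ×-dec extension? a b c 1F (circlePoint a b c 2) ×-dec extension? a b c 2F (circlePoint a b c 3)

opaque
  unfolding colour

  covered : ∀ {a} → a < 50 → ∀ {b} → b < 50 → a < b → ∀ {c} → c < 50 → b < c → Covered a b c
  covered = toWitness {a? = allUpTo? (λ a → allUpTo? (λ b → a <? b →-dec allUpTo? (λ c → b <? c →-dec covered? a b c) 50) 50) 50} _

covered⇒extension : ∀ {a b c} → Covered a b c → ∀ k → ∃ (Extension a b c k)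
covered⇒extension (some , _ , _) 0F = Any.satisfied some
covered⇒extension (_ , ext₁ , _) 1F = _ , ext₁
covered⇒extension (_ , _ , ext₂) 2F = _ , ext₂

extension⇒χ₀ : ∀ {T a b c k w} → elements T ≡ a ∷ b ∷ c ∷ [] → Extension a b c k w →
               ∃ λ x → x ∉ T × χ₀ (T ∪ ⁅ x ⁆) ≡ k
extension⇒χ₀ {T} {a} {b} {c} {k} {w} T≡abc (w<50 , w≢a , w≢b , w≢c , coloured) = x , x∉T , (begin
  colourL (elements (T ∪ ⁅ x ⁆))        ≡⟨ cong colourL (elements-∪ x∉T) ⟩
  colourL (insert (toℕ x) (elements T)) ≡⟨ cong₂ (λ v l → colourL (insert v l)) (toℕ-fromℕ< w<50) T≡abc ⟩
  colourL (insert w (a ∷ b ∷ c ∷ []))   ≡⟨ coloured ⟩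
  k                                     ∎)
  where
  open ≡-Reasoning
  x : Fin 50
  x = fromℕ< w<50
  x∉T : x ∉ T
  x∉T x∈T with subst (_∈ₗ a ∷ b ∷ c ∷ []) (toℕ-fromℕ< w<50) (subst (toℕ x ∈ₗ_) T≡abc (∈-elements x∈T))
  ... | here w≡a                 = w≢a w≡a
  ... | there (here w≡b)         = w≢b w≡b
  ... | there (there (here w≡c)) = w≢c w≡c

χ₀-covering : CoveringColouring χ₀
χ₀-covering k T ∣T∣≡3 = extend (elements T) refl (elements-sorted T) (elements-bounded T) (trans (length-elements T) ∣T∣≡3)
  where
  extend : ∀ xs → elements T ≡ xs → AllPairs _<_ xs → All (_< 50) xs → length xs ≡ 3 →
           ∃ λ x → x ∉ T × χ₀ (T ∪ ⁅ x ⁆) ≡ k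
  extend (a ∷ b ∷ c ∷ []) T≡abc ((a<b ∷ _) ∷ (b<c ∷ _) ∷ _) (a<50 ∷ b<50 ∷ c<50 ∷ []) _ =
    extension⇒χ₀ T≡abc (proj₂ (covered⇒extension (covered a<50 b<50 a<b c<50 b<c) k))
  extend [] _ _ _ ()
  extend (_ ∷ []) _ _ _ ()
  extend (_ ∷ _ ∷ []) _ _ _ ()
  extend (_ ∷ _ ∷ _ ∷ _ ∷ _) _ _ _ ()

χ₀-delete : ∀ S {x} → x ∈ S → ∃ λ i → χ₀ (S ∖ x) ≡ colourL (removeAt (elements S) i)
χ₀-delete S {x} x∈S = i , (begin
  χ₀ (S ∖ x)                                            ≡⟨ cong χ₀ (∖≡delete S x) ⟩
  χ₀ (delete S x)                                       ≡⟨ cong colourL (elements-delete S x) ⟩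
  colourL (remove (toℕ x) (elements S))                 ≡⟨ cong (λ v → colourL (remove v (elements S))) (lookup-index x∈xs) ⟩
  colourL (remove (lookup (elements S) i) (elements S)) ≡⟨ cong colourL (remove-lookup (elements-sorted S) i) ⟩
  colourL (removeAt (elements S) i)                     ∎)
  where
  open ≡-Reasoning
  x∈xs : toℕ x ∈ₗ elements S
  x∈xs = ∈-elements x∈S
  i : Fin (length (elements S))
  i = Any.index x∈xs

colour⁴ : (Fin 4 → Point) → Fin 3
colour⁴ f = colour (f 0F) (f 1F) (f 2F) (f 3F)

five-vertices-not-rainbow : ∀ {xs} → length xs ≡ 5 → AllPairs _<_ xs → All (_< 50) xs → ∀ {i₀ i₁ i₂} →
  colourL (removeAt xs i₀) ≡ 0F → colourL (removeAt xs i₁) ≡ 1F → colourL (removeAt xs i₂) ≡ 2F → ⊥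
five-vertices-not-rainbow {xs@(_ ∷ _ ∷ _ ∷ _ ∷ _ ∷ [])} _ sorted bounded {i₀} {i₁} {i₂} c₀ c₁ c₂ =
  colour-0 (trans (colour-without i₀) c₀)
    (five-point {f} nondeg {i₁} {i₂} {i₀} (separated c₁ c₂ λ ()) (separated c₀ c₁ λ ()) (separated c₀ c₂ λ ())
      (colour-≢0 λ c≡0 → 1≢0 (trans (sym (trans (colour-without i₁) c₁)) c≡0))
      (colour-≢0 λ c≡0 → 2≢0 (trans (sym (trans (colour-without i₂) c₂)) c≡0)))
  where
  f : Fin 5 → Point
  f = point ∘ lookup xs

  nondeg : Nondegenerate f
  nondeg {i} {j} i≢j =
    point-det-nonzero (All.lookup bounded (∈-lookup i)) (All.lookup bounded (∈-lookup j)) (i≢j ∘ lookup-injective sorted)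

  colour-without : ∀ i → colour⁴ (f ∘ punchIn i) ≡ colourL (removeAt xs i)
  colour-without 0F = refl
  colour-without 1F = refl
  colour-without 2F = refl
  colour-without 3F = refl
  colour-without 4F = refl

  separated : ∀ {i j k l} → colourL (removeAt xs i) ≡ k → colourL (removeAt xs j) ≡ l → k ≢ l → i ≢ j
  separated cᵢ cⱼ k≢l refl = k≢l (trans (sym cᵢ) cⱼ)

  1≢0 : 1F ≢ 0F
  1≢0 ()
  2≢0 : 2F ≢ 0F
  2≢0 ()
five-vertices-not-rainbow {[]} ()
five-vertices-not-rainbow {_ ∷ []} ()
five-vertices-not-rainbow {_ ∷ _ ∷ []} ()
five-vertices-not-rainbow {_ ∷ _ ∷ _ ∷ []} ()
five-vertices-not-rainbow {_ ∷ _ ∷ _ ∷ _ ∷ []} ()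
five-vertices-not-rainbow {_ ∷ _ ∷ _ ∷ _ ∷ _ ∷ _ ∷ _} ()

χ₀-no-rainbow : ∀ S → ¬ Rainbow5 χ₀ S
χ₀-no-rainbow S (∣S∣≡5 , rainbow) =
  five-vertices-not-rainbow (trans (length-elements S) ∣S∣≡5) (elements-sorted S) (elements-bounded S)
    (coloured 0F) (coloured 1F) (coloured 2F)
  where
  coloured : ∀ k → colourL (removeAt (elements S) (proj₁ (χ₀-delete S (proj₁ (proj₂ (rainbow k)))))) ≡ k
  coloured k = trans (sym (proj₂ (χ₀-delete S (proj₁ (proj₂ (rainbow k)))))) (proj₂ (proj₂ (rainbow k)))

open Duplication using (duplicate; duplicate-covering; duplicate-no-rainbow)

rainbow-free-covering-colouring : ∀ d →
  ∃ λ (χ : Colouring (50 ℕ.+ d)) → CoveringColouring χ × ((S : Subset (50 ℕ.+ d)) → ¬ Rainbow5 χ S)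
rainbow-free-covering-colouring zero    = χ₀ , χ₀-covering , χ₀-no-rainbow
rainbow-free-covering-colouring (suc d) with rainbow-free-covering-colouring d
... | χ , covering , no-rainbow = duplicate χ , duplicate-covering {χ = χ} covering , duplicate-no-rainbow {χ = χ} no-rainbow

lemma16 : ∃ λ (n₀ : ℕ) → (n : ℕ) → n ≥ n₀ →
    ∃ λ (χ : Colouring n) → CoveringColouring χ × ((S : Subset n) → ¬ Rainbow5 χ S)
lemma16 = 50 , λ n n≥50 →
  subst (λ n → ∃ λ (χ : Colouring n) → CoveringColouring χ × ((S : Subset n) → ¬ Rainbow5 χ S))
        (m+[n∸m]≡n n≥50) (rainbow-free-covering-colouring (n ℕ.∸ 50))
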